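{- Let $d\ge 4$ and $\ell\ge 3$ be integers. The diameter of the subKautz digraph $sK(d,\ell)$ is $2\ell-1$.
   Context: $sK(d,\ell)$ is the digraph whose vertices are the words $x_1x_2\ldots x_\ell$ over $\mathbb{Z}_{d+1}$ with $x_i\neq x_{i+1}$ for $i=1,\dots,\ell-1$, with arcs $x_1x_2\ldots x_\ell\to x_2\ldots x_\ell x_{\ell+1}$ for every $x_{\ell+1}\in\mathbb{Z}_{d+1}$ with $x_{\ell+1}\neq x_1,x_\ell$. The diameter is the maximum over ordered pairs of vertices of the directed distance. -}

module Defs where

open import Data.Nat using (ℕ; zero; suc; _≤_; _<_)
open import Data.Fin using (Fin)
open import Data.Vec using (Vec; []; _∷_; _∷ʳ_; head; last; tail)
open import Data.Product using (Σ; _×_; ∃; ∃-syntax; _,_; proj₁)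
open import Relation.Binary.PropositionalEquality using (_≡_; _≢_)
open import Relation.Nullary using (¬_)

-- Alphabet ℤ_{d+1} is represented by Fin (suc d).

NoRepeat : ∀ {n} {A : Set} → Vec A n → Set
NoRepeat [] = Data.Unit.⊤ where import Data.Unit
NoRepeat (x ∷ []) = Data.Unit.⊤ where import Data.Unit
NoRepeat (x ∷ y ∷ xs) = (x ≢ y) × NoRepeat (y ∷ xs)

Vertex : ℕ → ℕ → Set
Vertex d ℓ = Σ (Vec (Fin (suc d)) ℓ) NoRepeat

Arc : ∀ d m → Vertex d (suc m) → Vertex d (suc m) → Set
Arc d m (u , _) (v , _) =
  ∃[ z ] (z ≢ head u × z ≢ last u × v ≡ tail u ∷ʳ z)

data Walk (d m : ℕ) : ℕ → Vertex d (suc m) → Vertex d (suc m) → Set where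
  here : ∀ {u} → Walk d m zero u u
  step : ∀ {k u v w} → Arc d m u v → Walk d m k v w → Walk d m (suc k) u w

Distance : ∀ d m → Vertex d (suc m) → Vertex d (suc m) → ℕ → Set
Distance d m u v k = Walk d m k u v × (∀ j → j < k → ¬ Walk d m j u v)

HasDiameter : ∀ d m → ℕ → Set
HasDiameter d m D =
  (∀ u v → ∃[ k ] (k ≤ D × Distance d m u v k))
  × (∃[ u ] ∃[ v ] Distance d m u v D)

-- A walk of length k from u to w spells a word of length ℓ + k whose consecutive windows are
-- the vertices, the letter appended at step p being different from the head uₚ of the vertex it
-- leaves. So a walk with k < ℓ makes w begin with the last ℓ − k letters of u, and a walk of
-- length ℓ + t forces u₍ₜ₊ᵢ₎ ≠ wᵢ for all i. Conversely, when this holds for some t ≥ 1 and there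
-- are at least five letters, one appends t letters each avoiding at most four forbidden ones and
-- then the ℓ letters of w. Any pair satisfies the condition for t = ℓ − 1, or for t = ℓ − 2 when
-- w₀ = u₍ℓ₋₁₎, bounding the diameter by 2ℓ − 1; the pair u = …0101, w = 0212… attains it.

module Submission where

open import Defs
open import Data.Nat using (ℕ; zero; suc; _≤_; _<_; _+_; _∸_; _*_; z≤n; s≤s; s≤s⁻¹)
open import Data.Nat.Properties
  using ( ≤-refl; ≤-reflexive; ≤-trans; <⇒≤; <⇒≱; ≰⇒>; 1+n≰n; n≤1+n; m≤n⇒m<n∨m≡n; _≤?_
        ; +-comm; +-assoc; +-suc; +-identityʳ; suc-injective; +-cancelˡ-≡; +-cancelˡ-<
        ; m+n≤o⇒m≤o; m+n≤o⇒n≤o; m+1+n≰m; m+n∸m≡n; m≤n⇒∃[o]m+o≡n; anyUpTo? )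
open import Data.Nat.Induction using (<-rec)
open import Data.Fin using (Fin; zero; suc)
open import Data.Fin.Patterns using (0F; 1F; 2F)
open import Data.Fin.Properties using (_≟_; any?; pigeonhole; ¬∀⟶∃¬) renaming (<⇒≢ to <⇒≢ᶠ)
open import Data.Vec using (Vec; []; _∷_; _∷ʳ_; head; last; tail; lookup)
open import Data.Vec.Properties using (≡-dec; last-∷ʳ)
open import Data.Vec.Relation.Unary.Any as Any using (here; there)
open import Data.Vec.Relation.Unary.Any.Properties using (lookup-index)
open import Data.Vec.Membership.Propositional using (_∈_; _∉_)
open import Data.Product using (Σ; _×_; ∃-syntax; _,_; proj₁; proj₂)
open import Data.Sum using (_⊎_; inj₁; inj₂; swap; [_,_]′)
open import Data.Unit using (tt)
open import Data.Empty using (⊥; ⊥-elim)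
open import Function using (_∘_)
open import Relation.Binary.PropositionalEquality
  using (_≡_; _≢_; refl; sym; trans; cong; cong₂; subst; subst₂; ≢-sym; module ≡-Reasoning)
open import Relation.Nullary using (¬_; Dec; yes; no)
open import Relation.Nullary.Decidable using (map′)

-- Indices past the end of a word return its last letter.
infixl 10 _!_
_!_ : ∀ {X : Set} {n} → Vec X (suc n) → ℕ → X
(x ∷ [])    ! _     = x
(x ∷ y ∷ v) ! zero  = x
(x ∷ y ∷ v) ! suc i = (y ∷ v) ! i

module _ {X : Set} where

  !-head : ∀ {n} (v : Vec X (suc n)) → v ! 0 ≡ head v
  !-head (x ∷ [])    = refl
  !-head (x ∷ y ∷ v) = refl

  !-∷ʳ : ∀ {n} (v : Vec X (suc n)) z {i} → i ≤ n → (v ∷ʳ z) ! i ≡ v ! i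
  !-∷ʳ (x ∷ [])    z z≤n       = refl
  !-∷ʳ (x ∷ y ∷ v) z z≤n       = refl
  !-∷ʳ (x ∷ y ∷ v) z (s≤s i≤n) = !-∷ʳ (y ∷ v) z i≤n

  !-∷ʳ-end : ∀ {n} (v : Vec X n) z → (v ∷ʳ z) ! n ≡ z
  !-∷ʳ-end []          z = refl
  !-∷ʳ-end (x ∷ [])    z = refl
  !-∷ʳ-end (x ∷ y ∷ v) z = !-∷ʳ-end (y ∷ v) z

  !-tail-∷ʳ : ∀ {n} (v : Vec X (suc n)) z {i} → i < n → (tail v ∷ʳ z) ! i ≡ v ! suc i
  !-tail-∷ʳ (x ∷ y ∷ v) z (s≤s i≤n) = !-∷ʳ (y ∷ v) z i≤n

  !-ext : ∀ {n} (u v : Vec X (suc n)) → (∀ i → i ≤ n → u ! i ≡ v ! i) → u ≡ v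
  !-ext (x ∷ [])    (y ∷ [])    eq = cong (_∷ []) (eq 0 z≤n)
  !-ext (x ∷ x′ ∷ u) (y ∷ y′ ∷ v) eq =
    cong₂ _∷_ (eq 0 z≤n) (!-ext (x′ ∷ u) (y′ ∷ v) (λ i i≤n → eq (suc i) (s≤s i≤n)))

  window : (ℕ → X) → (n : ℕ) → Vec X n
  window f zero    = []
  window f (suc n) = f 0 ∷ window (f ∘ suc) n

  window-! : ∀ f n {i} → i ≤ n → window f (suc n) ! i ≡ f i
  window-! f zero    z≤n       = refl
  window-! f (suc n) z≤n       = refl
  window-! f (suc n) (s≤s i≤n) = window-! (f ∘ suc) n i≤n

  NoRepeat⇒!-≢ : ∀ {n} {v : Vec X (suc n)} → NoRepeat v → ∀ {i} → i < n → v ! i ≢ v ! suc i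
  NoRepeat⇒!-≢ {v = x ∷ y ∷ v} (x≢y , _) (s≤s z≤n)       = subst (x ≢_) (sym (!-head (y ∷ v))) x≢y
  NoRepeat⇒!-≢ {v = x ∷ y ∷ v} (_ , nr)  (s≤s (s≤s i<n)) = NoRepeat⇒!-≢ nr (s≤s i<n)

  NoRepeat-window : ∀ (f : ℕ → X) n → (∀ i → f i ≢ f (suc i)) → NoRepeat (window f n)
  NoRepeat-window f zero          _ = tt
  NoRepeat-window f (suc zero)    _ = tt
  NoRepeat-window f (suc (suc n)) f≢ = f≢ 0 , NoRepeat-window (f ∘ suc) (suc n) (f≢ ∘ suc)

  NoRepeat-∷ʳ : ∀ {n} (v : Vec X (suc n)) {z} → NoRepeat v → z ≢ last v → NoRepeat (v ∷ʳ z)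
  NoRepeat-∷ʳ (x ∷ [])    _        z≢x = (λ x≡z → z≢x (sym x≡z)) , tt
  NoRepeat-∷ʳ (x ∷ y ∷ v) (x≢y , nr) z≢ = x≢y , NoRepeat-∷ʳ (y ∷ v) nr z≢

  NoRepeat-tail-∷ʳ : ∀ {n} (v : Vec X (suc n)) {z} → NoRepeat v → z ≢ last v → NoRepeat (tail v ∷ʳ z)
  NoRepeat-tail-∷ʳ (x ∷ [])    _       _  = tt
  NoRepeat-tail-∷ʳ (x ∷ y ∷ v) (_ , nr) z≢ = NoRepeat-∷ʳ (y ∷ v) nr z≢

NoRepeat-irrelevant : ∀ {X : Set} {n} (v : Vec X n) (p q : NoRepeat v) → p ≡ q
NoRepeat-irrelevant []          _        _        = refl
NoRepeat-irrelevant (x ∷ [])    _        _        = refl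
NoRepeat-irrelevant (x ∷ y ∷ v) (x≢y , p) (_ , q) = cong (x≢y ,_) (NoRepeat-irrelevant (y ∷ v) p q)

not-all-∈ : ∀ {k n} (xs : Vec (Fin n) k) → k < n → ¬ (∀ z → z ∈ xs)
not-all-∈ xs k<n ∈xs with pigeonhole k<n (Any.index ∘ ∈xs)
... | i , j , i<j , same = <⇒≢ᶠ i<j (begin
  i                             ≡⟨ lookup-index (∈xs i) ⟩
  lookup xs (Any.index (∈xs i)) ≡⟨ cong (lookup xs) same ⟩
  lookup xs (Any.index (∈xs j)) ≡⟨ lookup-index (∈xs j) ⟨
  j                             ∎)
  where open ≡-Reasoning

fresh : ∀ {k n} (xs : Vec (Fin n) k) → k < n → ∃[ z ] z ∉ xs
fresh {n = n} xs k<n = ¬∀⟶∃¬ n (_∈ xs) (λ z → Any.any? (z ≟_) xs) (not-all-∈ xs k<n)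

module _ {d m : ℕ} where

  vertex-≡ : {u v : Vertex d (suc m)} → proj₁ u ≡ proj₁ v → u ≡ v
  vertex-≡ {x , p} {.x , q} refl = cong (x ,_) (NoRepeat-irrelevant x p q)

  extend : (u : Vertex d (suc m)) (z : Fin (suc d)) → z ≢ last (proj₁ u) → Vertex d (suc m)
  extend (x , nr) z z≢last = tail x ∷ʳ z , NoRepeat-tail-∷ʳ x nr z≢last

  _++ʷ_ : ∀ {j k u v w} → Walk d m j u v → Walk d m k v w → Walk d m (j + k) u w
  here          ++ʷ q = q
  step arc rest ++ʷ q = step arc (rest ++ʷ q)

  walk? : ∀ k (u w : Vertex d (suc m)) → Dec (Walk d m k u w)
  walk? zero u w = map′ (λ { eq → subst (Walk d m 0 u) (vertex-≡ eq) here }) (λ { here → refl })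
    (≡-dec _≟_ (proj₁ u) (proj₁ w))
  walk? (suc k) u@(x , _) w =
    map′ (λ { (z , z≢head , z≢last , walk) → step (z , z≢head , z≢last , refl) walk })
         (λ { (step {v = _ , _} (z , z≢head , z≢last , refl) walk) →
                z , z≢head , z≢last , subst (λ v → Walk d m k v w) (vertex-≡ refl) walk })
         (any? next?)
    where
    Next : Fin (suc d) → Set
    Next z = z ≢ head x × Σ (z ≢ last x) λ z≢last → Walk d m k (extend u z z≢last) w
    next? : ∀ z → Dec (Next z)
    next? z with z ≟ head x | z ≟ last x
    ... | yes z≡head | _          = no λ next → proj₁ next z≡head
    ... | no z≢head  | yes z≡last = no λ next → proj₁ (proj₂ next) z≡last
    ... | no z≢head  | no z≢last  = map′ (λ walk → z≢head , z≢last , walk) (proj₂ ∘ proj₂)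
                                         (walk? k (extend u z z≢last) w)

Least : (ℕ → Set) → ℕ → Set
Least P k = P k × (∀ j → j < k → ¬ P j)

least : ∀ {P : ℕ → Set} → (∀ k → Dec (P k)) → ∀ K → P K → ∃[ k ] (k ≤ K × Least P k)
least {P} P? = <-rec _ go
  where
  go : ∀ K → (∀ {J} → J < K → P J → ∃[ k ] (k ≤ J × Least P k)) →
       P K → ∃[ k ] (k ≤ K × Least P k)
  go K rec pK with anyUpTo? P? K
  ... | no none = K , ≤-refl , pK , λ j j<K pj → none (j , j<K , pj)
  ... | yes (J , J<K , pJ) with rec J<K pJ
  ...   | k , k≤J , pk , minimal = k , ≤-trans k≤J (<⇒≤ J<K) , pk , minimal

walk⇒distance : ∀ {d m K} {u v : Vertex d (suc m)} → Walk d m K u v → ∃[ k ] (k ≤ K × Distance d m u v k)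
walk⇒distance {K = K} {u} {v} = least (λ k → walk? k u v) K

module _ {X : Set} {m : ℕ} where

  Overlap Apart : ℕ → Vec X (suc m) → Vec X (suc m) → Set
  Overlap k x y = ∀ i → k + i ≤ m → y ! i ≡ x ! (k + i)
  Apart   k x y = ∀ i → k + i ≤ m → x ! (k + i) ≢ y ! i

  overlap-beyond : ∀ {k} (x y : Vec X (suc m)) → m < k → Overlap k x y
  overlap-beyond x y m<k i k+i≤m = ⊥-elim (<⇒≱ m<k (m+n≤o⇒m≤o _ k+i≤m))

  overlap-zero⇒≡ : (x y : Vec X (suc m)) → Overlap 0 x y → y ≡ x
  overlap-zero⇒≡ x y agree = !-ext y x agree

  overlap-tail-∷ʳ : ∀ {r a} (x y : Vec X (suc m)) → suc r + a ≡ suc m →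
                    Overlap (suc r) x y → Overlap r (tail x ∷ʳ y ! a) y
  overlap-tail-∷ʳ {r} {a} x y r+a≡m agree i r+i≤m with m≤n⇒m<n∨m≡n r+i≤m
  ... | inj₁ r+i<m = trans (agree i r+i<m) (sym (!-tail-∷ʳ x (y ! a) r+i<m))
  ... | inj₂ r+i≡m = begin
    y ! i                       ≡⟨ cong (y !_) (+-cancelˡ-≡ r i a (trans r+i≡m r+a≡m′)) ⟩
    y ! a                       ≡⟨ !-∷ʳ-end (tail x) (y ! a) ⟨
    (tail x ∷ʳ y ! a) ! m       ≡⟨ cong ((tail x ∷ʳ y ! a) !_) r+i≡m ⟨
    (tail x ∷ʳ y ! a) ! (r + i) ∎
    where
    open ≡-Reasoning
    r+a≡m′ : m ≡ r + a
    r+a≡m′ = sym (suc-injective r+a≡m)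

  apart-tail-∷ʳ : ∀ {a} (x y : Vec X (suc m)) z → Apart a y x → Apart (suc a) y (tail x ∷ʳ z)
  apart-tail-∷ʳ {a} x y z apart i a+i<m =
    subst₂ _≢_ (cong (y !_) (+-suc a i)) (sym (!-tail-∷ʳ x z (m+n≤o⇒n≤o a a+1+i≤m)))
      (apart (suc i) a+1+i≤m)
    where
    a+1+i≤m : a + suc i ≤ m
    a+1+i≤m = subst (_≤ m) (sym (+-suc a i)) a+i<m

  apart-zero : ∀ {k} (x y : Vec X (suc m)) → Apart k x y → k ≤ m → x ! k ≢ y ! 0
  apart-zero {k} x y apart k≤m =
    subst (_≢ y ! 0) (cong (x !_) (+-identityʳ k)) (apart 0 (subst (_≤ m) (sym (+-identityʳ k)) k≤m))

  apart-last : (x y : Vec X (suc m)) → x ! m ≢ y ! 0 → Apart m x y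
  apart-last x y xₘ≢y₀ zero    _        = subst (λ j → x ! j ≢ y ! 0) (sym (+-identityʳ m)) xₘ≢y₀
  apart-last x y _     (suc i) m+1+i≤m _ = m+1+n≰m m m+1+i≤m

last≡head⇒apart : ∀ {X : Set} {k} (x y : Vec X (suc (suc k))) → NoRepeat x → NoRepeat y →
                  y ! 0 ≡ x ! suc k → Apart k x y
last≡head⇒apart {k = k} x y nrx nry y₀≡xₘ = λ
  { zero _ → subst (_≢ y ! 0) (cong (x !_) (sym (+-identityʳ k)))
                   (subst (x ! k ≢_) (sym y₀≡xₘ) (NoRepeat⇒!-≢ nrx ≤-refl))
  ; (suc zero) _ → subst (_≢ y ! 1) (trans y₀≡xₘ (cong (x !_) (+-comm 1 k)))
                         (NoRepeat⇒!-≢ nry (s≤s z≤n))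
  ; (suc (suc i)) k+2+i≤1+k _ → m+1+n≰m k (s≤s⁻¹ (subst (_≤ suc k) (+-suc k (suc i)) k+2+i≤1+k))
  }

module _ {d m : ℕ} where

  walk⇒overlap : ∀ {k u w} → Walk d m k u w → Overlap k (proj₁ u) (proj₁ w)
  walk⇒overlap here i _ = refl
  walk⇒overlap {u = x , _} (step {v = _ , _} (z , _ , _ , refl) rest) i k+i<m =
    trans (walk⇒overlap rest i (<⇒≤ k+i<m)) (!-tail-∷ʳ x z k+i<m)

  -- wᵢ is the letter appended at step p, when uₚ was the head.
  walk⇒apart-at : ∀ {k u w} → Walk d m k u w →
                ∀ p i → p ≤ m → i ≤ m → p + suc m ≡ k + i → proj₁ u ! p ≢ proj₁ w ! i
  walk⇒apart-at here p i _ i≤m p+ℓ≡i _ = 1+n≰n (m+n≤o⇒n≤o p (subst (_≤ m) (sym p+ℓ≡i) i≤m))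
  walk⇒apart-at {suc k} {u = x , _} {w} (step {v = _ , _} (z , z≢head , _ , refl) rest)
                zero i _ _ m≡k+i x₀≡wᵢ =
    z≢head (begin
      z                        ≡⟨ !-∷ʳ-end (tail x) z ⟨
      (tail x ∷ʳ z) ! m        ≡⟨ cong ((tail x ∷ʳ z) !_) (suc-injective m≡k+i) ⟩
      (tail x ∷ʳ z) ! (k + i)  ≡⟨ walk⇒overlap rest i (subst (_≤ m) (suc-injective m≡k+i) ≤-refl) ⟨
      proj₁ w ! i              ≡⟨ x₀≡wᵢ ⟨
      x ! 0                    ≡⟨ !-head x ⟩
      head x                   ∎)
    where open ≡-Reasoning
  walk⇒apart-at {u = x , _} (step {v = _ , _} (z , _ , _ , refl) rest) (suc p) i p<m i≤m eq =
    subst (_≢ _) (!-tail-∷ʳ x z p<m) (walk⇒apart-at rest p i (<⇒≤ p<m) i≤m (suc-injective eq))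

  walk⇒apart : ∀ {t u w} → Walk d m (suc m + t) u w → Apart t (proj₁ u) (proj₁ w)
  walk⇒apart {t} walk i t+i≤m = walk⇒apart-at walk (t + i) i t+i≤m (m+n≤o⇒n≤o t t+i≤m)
    (trans (+-comm (t + i) (suc m)) (sym (+-assoc (suc m) t i)))

  -- r + 1 steps remain and y₀ … y₍ₐ₋₁₎ have already been appended: they end the current vertex c
  -- (Overlap), and the letters of y still to come differ from the heads they will meet (Apart).
  overlap⇒walk : ∀ r a (c y : Vertex d (suc m)) → suc r + a ≡ suc m →
                 Overlap (suc r) (proj₁ c) (proj₁ y) → Apart a (proj₁ y) (proj₁ c) →
                 proj₁ y ! a ≢ last (proj₁ c) → Walk d m (suc r) c y
  overlap⇒walk zero a (x , _) (y , _) r+a≡m agree apart yₐ≢last =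
    step (y ! a , yₐ≢head , yₐ≢last , overlap-zero⇒≡ _ _ (overlap-tail-∷ʳ x y r+a≡m agree)) here
    where
    yₐ≢head : y ! a ≢ head x
    yₐ≢head = subst (_ ≢_) (!-head x) (apart-zero y x apart (≤-reflexive (suc-injective r+a≡m)))
  overlap⇒walk (suc r) a c@(x , _) y@(y′ , nry) r+a≡m agree apart yₐ≢last =
    step (y′ ! a , yₐ≢head , yₐ≢last , refl)
      (overlap⇒walk r (suc a) (extend c (y′ ! a) yₐ≢last) y (trans (cong suc (+-suc r a)) r+a≡m)
        (overlap-tail-∷ʳ x y′ r+a≡m agree) (apart-tail-∷ʳ x y′ (y′ ! a) apart)
        (λ eq → NoRepeat⇒!-≢ nry a<m (sym (trans eq (last-∷ʳ (y′ ! a) (tail x))))))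
    where
    a<m : a < m
    a<m = m+n≤o⇒n≤o r (≤-reflexive (trans (+-suc r a) (suc-injective r+a≡m)))
    yₐ≢head : y′ ! a ≢ head x
    yₐ≢head = subst (_ ≢_) (!-head x) (apart-zero y′ x apart (<⇒≤ a<m))

  Ready : Vertex d (suc m) → Vertex d (suc m) → Set
  Ready (v , _) (y , _) = Apart 0 v y × y ! 0 ≢ last v

  ready⇒walk : ∀ {v y} → Ready v y → Walk d m (suc m) v y
  ready⇒walk {v} {y} (apart , y₀≢last) =
    overlap⇒walk m 0 v y (cong suc (+-identityʳ m)) (overlap-beyond (proj₁ v) (proj₁ y) ≤-refl)
      (λ i i≤m → ≢-sym (apart i i≤m)) y₀≢last

module _ {e m : ℕ} where

  -- The new letter avoids the head and the last letter of u, the letter of y it will face, and y₀.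
  apart-suc⇒arc : ∀ {s} (u y : Vertex (4 + e) (suc m)) → Apart (suc s) (proj₁ u) (proj₁ y) →
                  ∃[ v ] (Arc (4 + e) m u v × Apart s (proj₁ v) (proj₁ y) × proj₁ y ! 0 ≢ last (proj₁ v))
  apart-suc⇒arc {s} u@(x , _) (y , _) apart
    with fresh (head x ∷ last x ∷ y ! (m ∸ s) ∷ y ! 0 ∷ []) (s≤s (s≤s (s≤s (s≤s (s≤s z≤n)))))
  ... | z , z∉ =
    extend u z (z∉ ∘ there ∘ here) , (z , z∉ ∘ here , z∉ ∘ there ∘ here , refl) , apart′ , y₀≢z
    where
    y₀≢z : y ! 0 ≢ last (tail x ∷ʳ z)
    y₀≢z y₀≡ = z∉ (there (there (there (here (sym (trans y₀≡ (last-∷ʳ z (tail x))))))))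
    apart′ : Apart s (tail x ∷ʳ z) y
    apart′ i s+i≤m with m≤n⇒m<n∨m≡n s+i≤m
    ... | inj₁ s+i<m = subst (_≢ y ! i) (sym (!-tail-∷ʳ x z s+i<m)) (apart i s+i<m)
    ... | inj₂ s+i≡m = subst₂ _≢_ zₘ yᵢ (z∉ ∘ there ∘ there ∘ here)
      where
      zₘ : z ≡ (tail x ∷ʳ z) ! (s + i)
      zₘ = sym (trans (cong ((tail x ∷ʳ z) !_) s+i≡m) (!-∷ʳ-end (tail x) z))
      yᵢ : y ! (m ∸ s) ≡ y ! i
      yᵢ = cong (y !_) (trans (cong (_∸ s) (sym s+i≡m)) (m+n∸m≡n s i))

  apart-suc⇒walk-ready : ∀ g (u y : Vertex (4 + e) (suc m)) → Apart (suc g) (proj₁ u) (proj₁ y) →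
                         ∃[ v ] (Walk (4 + e) m (suc g) u v × Ready v y)
  apart-suc⇒walk-ready zero u y apart with apart-suc⇒arc u y apart
  ... | v , arc , ready = v , step arc here , ready
  apart-suc⇒walk-ready (suc g) u y apart with apart-suc⇒arc u y apart
  ... | v , arc , apart′ , _ with apart-suc⇒walk-ready g v y apart′
  ...   | w , walk , ready = w , step arc walk , ready

  apart⇒walk : ∀ {g} (u y : Vertex (4 + e) (suc m)) → Apart (suc g) (proj₁ u) (proj₁ y) →
               Walk (4 + e) m (suc g + suc m) u y
  apart⇒walk {g} u y apart with apart-suc⇒walk-ready g u y apart
  ... | v , walk , ready = walk ++ʷ ready⇒walk ready

walk-of-length≤ : ∀ {e n} (u w : Vertex (4 + e) (3 + n)) →
              ∃[ k ] (k ≤ (2 + n) + (3 + n) × Walk (4 + e) (2 + n) k u w)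
walk-of-length≤ {e} {n} u@(x , nrx) w@(y , nry) with x ! (2 + n) ≟ y ! 0
... | no  xₘ≢y₀ = _ , ≤-refl , apart⇒walk u w (apart-last x y xₘ≢y₀)
... | yes xₘ≡y₀ = _ , n≤1+n _ , apart⇒walk u w (last≡head⇒apart x y nrx nry (sym xₘ≡y₀))

alternate : ∀ {A : Set} → A → A → ℕ → A
alternate a b zero    = a
alternate a b (suc i) = alternate b a i

module _ {A : Set} where

  alternate-≢-suc : ∀ (a b : A) → a ≢ b → ∀ i → alternate a b i ≢ alternate a b (suc i)
  alternate-≢-suc a b a≢b zero    = a≢b
  alternate-≢-suc a b a≢b (suc i) = alternate-≢-suc b a (≢-sym a≢b) i

  alternate-avoids : ∀ {a b c : A} → a ≢ c → b ≢ c → ∀ i → alternate a b i ≢ c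
  alternate-avoids a≢c b≢c zero    = a≢c
  alternate-avoids a≢c b≢c (suc i) = alternate-avoids b≢c a≢c i

  alternate-values : ∀ (a b : A) i → alternate a b i ≡ a ⊎ alternate a b i ≡ b
  alternate-values a b zero    = inj₁ refl
  alternate-values a b (suc i) = swap (alternate-values b a i)

  alternate-even : ∀ (a b : A) n → alternate a b (n + n) ≡ a
  alternate-even a b zero    = refl
  alternate-even a b (suc n) = trans (cong (alternate b a) (+-suc n n)) (alternate-even a b n)

module _ {e k : ℕ} where

  private
    m = suc k

  source-letter : ℕ → Fin (5 + e)
  source-letter i = alternate 1F 0F (i + m)

  source target : Vertex (4 + e) (suc m)
  source = window source-letter (suc m) , NoRepeat-window _ (suc m) (λ i → alternate-≢-suc 1F 0F (λ ()) (i + m))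
  target = 0F ∷ window (alternate 2F 1F) m , (λ ()) , NoRepeat-window _ m (alternate-≢-suc 2F 1F (λ ()))

  source-! : ∀ {i} → i ≤ m → proj₁ source ! i ≡ source-letter i
  source-! = window-! source-letter m

  target-! : ∀ {i} → i ≤ k → proj₁ target ! suc i ≡ alternate 2F 1F i
  target-! = window-! (alternate 2F 1F) k

  source-last : source-letter m ≡ 1F
  source-last = alternate-even 1F 0F m

  source-penultimate : source-letter k ≡ 0F
  source-penultimate = trans (cong (alternate 1F 0F) (+-suc k k)) (alternate-even 0F 1F k)

  source-letter≢2F : ∀ i → source-letter i ≢ 2F
  source-letter≢2F i = alternate-avoids {a = 1F} {b = 0F} (λ ()) (λ ()) (i + m)

  private
    1F≢0F : _≢_ {A = Fin (5 + e)} 1F 0F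
    1F≢0F ()

  source-!-last : proj₁ source ! m ≡ 1F
  source-!-last = trans (source-! ≤-refl) source-last

  no-overlap : ∀ {j} → Overlap j (proj₁ source) (proj₁ target) → j ≤ m → ⊥
  no-overlap {j} agree j≤m with m≤n⇒m<n∨m≡n j≤m
  ... | inj₁ j<m = source-letter≢2F (j + 1) (sym (begin
    2F                       ≡⟨ target-! z≤n ⟨
    proj₁ target ! 1         ≡⟨ agree 1 j+1≤m ⟩
    proj₁ source ! (j + 1)   ≡⟨ source-! j+1≤m ⟩
    source-letter (j + 1)    ∎))
    where
    open ≡-Reasoning
    j+1≤m : j + 1 ≤ m
    j+1≤m = subst (_≤ m) (+-comm 1 j) j<m
  ... | inj₂ refl = 1F≢0F (sym (begin
    0F                       ≡⟨ agree 0 (≤-reflexive (+-identityʳ m)) ⟩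
    proj₁ source ! (m + 0)   ≡⟨ cong (proj₁ source !_) (+-identityʳ m) ⟩
    proj₁ source ! m         ≡⟨ source-!-last ⟩
    1F                       ∎))
    where open ≡-Reasoning

  no-apart : ∀ {t} → Apart t (proj₁ source) (proj₁ target) → t < m → ⊥
  no-apart {t} apart t<m = [ t<k⇒⊥ , t≡k⇒⊥ ]′ (m≤n⇒m<n∨m≡n (s≤s⁻¹ t<m))
    where
    sₜ≢0F : source-letter t ≢ 0F
    sₜ≢0F = subst (_≢ 0F) (source-! (<⇒≤ t<m))
                  (apart-zero (proj₁ source) (proj₁ target) apart (<⇒≤ t<m))
    sₜ≡1F : source-letter t ≡ 1F
    sₜ≡1F = [ (λ eq → eq) , (λ eq → ⊥-elim (sₜ≢0F eq)) ]′ (alternate-values 1F 0F (t + m))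
    t≡k⇒⊥ : t ≡ k → ⊥
    t≡k⇒⊥ refl = sₜ≢0F source-penultimate
    t<k⇒⊥ : t < k → ⊥
    t<k⇒⊥ t<k = apart 2 t+2≤m (begin
      proj₁ source ! (t + 2)   ≡⟨ source-! t+2≤m ⟩
      source-letter (t + 2)    ≡⟨ cong source-letter (+-comm t 2) ⟩
      source-letter t          ≡⟨ sₜ≡1F ⟩
      1F                       ≡⟨ target-! (≤-trans (s≤s z≤n) t<k) ⟨
      proj₁ target ! 2         ∎)
      where
      open ≡-Reasoning
      t+2≤m : t + 2 ≤ m
      t+2≤m = subst (_≤ m) (+-comm 2 t) (s≤s t<k)

  source-to-target : Walk (4 + e) m (m + suc m) source target
  source-to-target = apart⇒walk source target
    (apart-last (proj₁ source) (proj₁ target) λ sₘ≡0F → 1F≢0F (trans (sym source-!-last) sₘ≡0F))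

  no-shorter-walk : ∀ j → j < m + suc m → ¬ Walk (4 + e) m j source target
  no-shorter-walk j j<D walk with j ≤? m
  ... | yes j≤m = no-overlap (walk⇒overlap walk) j≤m
  ... | no j≰m with m≤n⇒∃[o]m+o≡n (≰⇒> j≰m)
  ...   | t , refl =
    no-apart (walk⇒apart walk) (+-cancelˡ-< (suc m) t m (subst (suc m + t <_) (+-comm m (suc m)) j<D))

diameter : ∀ e n → HasDiameter (4 + e) (2 + n) ((2 + n) + (3 + n))
diameter e n = within , source , target , source-to-target , no-shorter-walk
  where
  within : ∀ u w → ∃[ k ] (k ≤ (2 + n) + (3 + n) × Distance (4 + e) (2 + n) u w k)
  within u w with walk-of-length≤ u w
  ... | K , K≤D , walk with walk⇒distance walk
  ...   | k , k≤K , distance = k , ≤-trans k≤K K≤D , distance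

mainTheorem5 : (d ℓ : ℕ) → 4 ≤ d → 3 ≤ ℓ →
    HasDiameter d (ℓ ∸ 1) (2 * ℓ ∸ 1)
mainTheorem5 (suc (suc (suc (suc e)))) (suc (suc (suc n)))
             (s≤s (s≤s (s≤s (s≤s z≤n)))) (s≤s (s≤s (s≤s z≤n))) =
  subst (HasDiameter (4 + e) (2 + n)) (cong ((2 + n) +_) (sym (+-identityʳ (3 + n)))) (diameter e n)
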